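{- Let $r$ be an integer with $0 \le r \le \frac{n}{2}$, let $L=(l_1,\dots,l_r)$ be a tuple of distinct indices in $[1,n]$, and let $F$ be a flag of asymmetry level $r$. Then \[ \phi_{F,L} - \sum_{A \subseteq [1,r]} \frac{\sum_{\pi \in S_r:\, \pi(i)=i\ \forall i \notin A} p_{F,(l_{\pi(1)},\dots,l_{\pi(r)})}}{\prod_{j=0}^{|A|-1}(n-r-j)} \] is a linear combination of polynomials $p_{F',L'}$ where $F'$ is obtained from $F$ by taking one or more of the labeled vertices and making them unlabeled, and $L'$ is a tuple of length $r_{F'}$.
   Context: Setting: $E_P$ is a set of (ordered or unordered) subsets ("hyperedges") of $[1,n]$ invariant under permutations, with a variable $x_e$ for each $e\in E_P$. Tuples consist of distinct indices in $[1,n]$. Empty products equal $1$. $S_r$ is the symmetric group on $[1,r]$. A flag $F$ consists of a tuple of distinct labeled vertices $V_{labeled}=(v_1,\dots,v_{r_F})$, a tuple of distinct unlabeled vertices $V_{free}$, and a finite multiset $H_F$ of hyperedges (of the same kind as in $E_P$) on $V(H_F)=V_{labeled}\cup V_{free}$ with every vertex in some hyperedge; $r_F$ is its asymmetry level. Making labeled vertices unlabeled means keeping $H_F$, removing them from $V_{labeled}$ (keeping the order of the rest) and adding them to $V_{free}$. For injective $\sigma:V(H_F)\to[1,n]$, $x_{\sigma(H_F)}=\prod_{e\in H_F}x_{\sigma(e)}$; for a tuple $L$ of length $r_F$, $p_{F,L}=\sum_\sigma x_{\sigma(H_F)}$ over injective $\sigma$ with $\sigma(v_i)=l_i$ for all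 $i$. For tuples $L,L'$ of the same length $r$: $c(L,L')=0$ if $l'_j=l_i$ for some $i\ne j$; otherwise, with $z=|\{i:l'_i\ne l_i\}|$, $c(L,L')=\frac{(-1)^z}{\prod_{j=0}^{z-1}(n-r-j)}$. $\phi_{F,L}=\sum_{L'}c(L,L')p_{F,L'}$ over all tuples $L'$ of length $r_F$. -}

module Defs where

open import Data.Bool using (Bool; T?; true; false; _∧_; _∨_; not; if_then_else_)
open import Data.Nat as ℕ using (ℕ; zero; suc; _∸_; _<_)
open import Data.Integer using (+_)
open import Data.Fin as Fin using (Fin)
open import Data.Fin.Properties using () renaming (_≟_ to _≟F_)
open import Data.List as List using (List; []; _∷_; concatMap; filter; foldr; allFin)
open import Data.List.Relation.Unary.All using (All)
open import Data.List.Relation.Unary.Any using (Any)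
open import Data.List.Membership.Propositional using (_∈_)
open import Data.List.Relation.Unary.Unique.Propositional using (Unique)
import Data.List.Relation.Unary.Unique.DecPropositional as UD
open import Data.List.Relation.Binary.Sublist.Propositional using (_⊆_)
open import Data.List.Relation.Binary.Permutation.Propositional using (_↭_)
open import Data.Vec as Vec using (Vec; []; _∷_; lookup; tabulate; toList)
open import Data.Vec.Properties using () renaming (≡-dec to ≡-decVec)
open import Data.Rational using (ℚ; 0ℚ; 1ℚ; _+_; _*_; -_; _-_; 1/_; _/_; ≢-nonZero)
open import Data.Rational.Properties using () renaming (_≟_ to _≟ℚ_)
open import Data.Product using (_×_)
open import Relation.Nullary using (¬_; yes; no)
open import Relation.Nullary.Decidable using (⌊_⌋)
open import Relation.Binary.PropositionalEquality using (_≡_)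

sumℚ : List ℚ → ℚ
sumℚ = foldr _+_ 0ℚ

prodℚ : List ℚ → ℚ
prodℚ = foldr _*_ 1ℚ

natℚ : ℕ → ℚ
natℚ k = (+ k) / 1

-- total inverse (1/0 := 0); only ever applied to nonzero numbers
-- under the hypotheses of the theorem (2r ≤ n)
invℚ : ℚ → ℚ
invℚ p with p ≟ℚ 0ℚ
... | yes _  = 0ℚ
... | no p≢0 = 1/_ p {{≢-nonZero p≢0}}

fall : ℕ → ℕ → ℕ → ℕ
fall n r zero    = 1
fall n r (suc z) = fall n r z ℕ.* (n ∸ r ∸ z)

sign : ℕ → ℚ
sign zero    = 1ℚ
sign (suc z) = - sign z

anyFin : ∀ {r} → (Fin r → Bool) → Bool
anyFin {r} f = foldr _∨_ false (List.map f (allFin r))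

allFinB : ∀ {r} → (Fin r → Bool) → Bool
allFinB {r} f = foldr _∧_ true (List.map f (allFin r))

countFin : ∀ {r} → (Fin r → Bool) → ℕ
countFin {r} f = foldr (λ b k → if b then suc k else k) 0 (List.map f (allFin r))

allVecOf : ∀ {A : Set} → List A → (m : ℕ) → List (Vec A m)
allVecOf xs zero    = [] ∷ []
allVecOf xs (suc m) = concatMap (λ a → List.map (a ∷_) (allVecOf xs m)) xs

-- all tuples (l_1,…,l_m) of distinct indices of Fin n
-- (equivalently: all injective maps Fin m → Fin n)
tuples : (n m : ℕ) → List (Vec (Fin n) m)
tuples n m = filter (λ v → UD.unique? _≟F_ (toList v)) (allVecOf (allFin n) m)

subsets : (r : ℕ) → List (Vec Bool r)
subsets r = allVecOf (true ∷ false ∷ []) r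

card : ∀ {r} → Vec Bool r → ℕ
card A = countFin (lookup A)

-- the symmetric group S_r (a permutation π is the tuple (π(1),…,π(r)))
perms : (r : ℕ) → List (Vec (Fin r) r)
perms r = tuples r r

-- Variable assignments: x_e for hyperedges e (lists of indices).
-- Admissible: x_e = 0 for e ∉ E_P (no such variable), and in the
-- unordered case x_e depends only on the underlying set of e.

Admissible : ∀ {n} → Bool → (List (Fin n) → Set) → (List (Fin n) → ℚ) → Set
Admissible ordered EP x =
  (∀ e → ¬ EP e → x e ≡ 0ℚ) ×
  (ordered ≡ false → ∀ e e′ → e ↭ e′ → x e ≡ x e′)

-- Flags on vertex set Fin m with asymmetry level r.
-- The labeled vertices form the tuple `labeled`; the free vertices are
-- the remaining elements of Fin m.

record Flag (m r : ℕ) : Set where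
  field
    labeled          : Vec (Fin m) r
    labeled-distinct : Unique (toList labeled)
    edges            : List (List (Fin m))
    edges-distinct   : All Unique edges
    covers           : ∀ (v : Fin m) → Any (v ∈_) edges

open Flag public

Unlabels : ∀ {m r r′} → Flag m r′ → Flag m r → Set
Unlabels {m} {r} {r′} F′ F =
  (edges F′ ≡ edges F) × (r′ < r) × (toList (labeled F′) ⊆ toList (labeled F))

p : ∀ {n m r} → Flag m r → Vec (Fin n) r → (List (Fin n) → ℚ) → ℚ
p {n} {m} F L x =
  sumℚ (List.map (λ σ → prodℚ (List.map (λ e → x (List.map (lookup σ) e)) (edges F)))
                 (filter (λ σ → ≡-decVec _≟F_ (Vec.map (lookup σ) (labeled F)) L)
                         (tuples n m)))

c : ∀ {n r} → Vec (Fin n) r → Vec (Fin n) r → ℚ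
c {n} {r} L L′ =
  if anyFin (λ i → anyFin (λ j → not ⌊ i ≟F j ⌋ ∧ ⌊ lookup L′ j ≟F lookup L i ⌋))
  then 0ℚ
  else sign z * invℚ (natℚ (fall n r z))
  where
  z = countFin (λ i → not ⌊ lookup L′ i ≟F lookup L i ⌋)

φ : ∀ {n m r} → Flag m r → Vec (Fin n) r → (List (Fin n) → ℚ) → ℚ
φ {n} {m} {r} F L x = sumℚ (List.map (λ L′ → c L L′ * p F L′ x) (tuples n r))

symSum : ∀ {n m r} → Flag m r → Vec (Fin n) r → (List (Fin n) → ℚ) → ℚ
symSum {n} {m} {r} F L x =
  sumℚ (List.map (λ A → invℚ (natℚ (fall n r (card A))) *
                         sumℚ (List.map (λ π → p F (tabulate (λ i → lookup L (lookup π i))) x)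
                                        (filter (λ π → T? (allFinB (λ i → lookup A i ∨ ⌊ lookup π i ≟F i ⌋)))
                                                (perms r))))
                 (subsets r))

record Term (n : ℕ) {m r : ℕ} (F : Flag m r) : Set where
  field
    r′          : ℕ
    F′          : Flag m r′
    unlabels    : Unlabels F′ F
    L′          : Vec (Fin n) r′
    L′-distinct : Unique (toList L′)
    coeff       : ℚ

evalTerms : ∀ {n m r} {F : Flag m r} → List (Term n F) → (List (Fin n) → ℚ) → ℚ
evalTerms ts x = sumℚ (List.map (λ t → Term.coeff t * p (Term.F′ t) (Term.L′ t) x) ts)

-- Both φ_{F,L} and the symmetrized sum are combinations ∑_S g(S) p_{F,S} over distinct tuples S,
-- so it suffices to compare the coefficient functions g. For A ⊆ [1,r] let e_{A,j}(s) be [s ∈ L]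
-- if j ∈ A and [s = l_j] otherwise. The number of permutations fixing [1,r] ∖ A that carry L to S
-- is ∏_j e_{A,j}(S_j), while c(L,S) = ∑_A ∏_j (e_{A,j}(S_j) - [j ∈ A]) / ∏_{i<|A|} (n-r-i), since
-- only A = {j : S_j ≠ l_j} contributes. So the difference of coefficients is, for each A, a
-- multiple of ∏_j (e_{A,j}(S_j) - [j ∈ A]) - ∏_j e_{A,j}(S_j); every monomial of this expansion
-- misses some factor e_{A,j}, hence does not depend on S_j, and a function of S that ignores S_j
-- is a combination of the p_{F′,S′} where F′ has the j-th labeled vertex made unlabeled.

module Submission where

open import Defs
open import Data.Bool using (Bool; true; false; if_then_else_; _∧_; _∨_; not; T?)
open import Data.Bool.Properties using (∨-zeroʳ) renaming (_≟_ to _≟B_)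
open import Data.Nat using (ℕ; zero; suc; _*_; _≤_)
open import Data.Nat.Properties using (n<1+n)
open import Data.Fin using (Fin; zero; suc)
open import Data.Fin.Properties using (suc-injective; 0≢1+n; any?) renaming (_≟_ to _≟F_)
open import Data.Fin.Permutation using (Permutation′; _⟨$⟩ʳ_)
open import Data.List as List using (List; []; _∷_; _++_; concatMap; filter; allFin; map)
open import Data.List.Properties using (map-∘; map-cong; map-tabulate)
open import Data.List.Membership.Propositional using (mapWith∈)
open import Data.List.Membership.Propositional.Properties using (map-mapWith∈; mapWith∈≗map; ∈-filter⁻)
open import Data.List.Relation.Unary.All using (All; []; _∷_)
open import Data.List.Relation.Unary.AllPairs using ([]; _∷_)
open import Data.List.Relation.Unary.Unique.Propositional using (Unique)
import Data.List.Relation.Unary.Unique.DecPropositional as UniqueDec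
open import Data.List.Relation.Binary.Sublist.Propositional using (_⊆_; []; _∷_; _∷ʳ_; ⊆-refl)
open import Data.List.Relation.Binary.Sublist.Propositional.Properties using (All-resp-⊆)
open import Data.Vec as Vec using (Vec; []; _∷_; lookup; tabulate; toList; removeAt)
open import Data.Vec.Properties using (lookup-map; lookup∘tabulate)
  renaming (≡-dec to ≡-decVec)
open import Data.Rational using (ℚ; 0ℚ; 1ℚ; _+_; -_; _-_) renaming (_*_ to _·_)
open import Data.Rational.Properties
  using (+-identityˡ; +-identityʳ; +-assoc; +-inverseʳ; *-identityˡ; *-identityʳ; *-zeroˡ; *-zeroʳ;
         *-comm; *-assoc; *-distribˡ-+; neg-distrib-+; neg-distribˡ-*; +-*-ring)
open import Algebra.Properties.Ring +-*-ring using (x[y-z]≈xy-xz)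
open import Data.Rational.Solver using (module +-*-Solver)
open +-*-Solver using (solve; _:=_; _:+_; _:*_; _:-_; :-_)
open import Data.Product using (Σ; ∃; ∃₂; _×_; _,_; proj₂)
open import Function using (_∘_)
open import Relation.Nullary using (¬_; Dec; yes; no; does; contradiction; ¬?; _×-dec_)
open import Relation.Nullary.Decidable using (⌊_⌋; dec-true; dec-false; isYes≗does)
open import Relation.Unary using (Decidable)
open import Relation.Binary.Definitions using (DecidableEquality)
open import Relation.Binary.PropositionalEquality
open ≡-Reasoning

private variable
  A B X : Set
  n r : ℕ

∑ : List A → (A → ℚ) → ℚ
∑ xs f = sumℚ (map f xs)

∑-cong : (xs : List A) {f g : A → ℚ} → (∀ a → f a ≡ g a) → ∑ xs f ≡ ∑ xs g
∑-cong xs eq = cong sumℚ (map-cong eq xs)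

∑-zero : (xs : List A) {f : A → ℚ} → (∀ a → f a ≡ 0ℚ) → ∑ xs f ≡ 0ℚ
∑-zero []       eq = refl
∑-zero (x ∷ xs) eq = cong₂ _+_ (eq x) (∑-zero xs eq)

∑-+ : (xs : List A) (f g : A → ℚ) → ∑ xs (λ a → f a + g a) ≡ ∑ xs f + ∑ xs g
∑-+ []       f g = refl
∑-+ (x ∷ xs) f g = trans (cong (f x + g x +_) (∑-+ xs f g))
  (solve 4 (λ a b c d → (a :+ b) :+ (c :+ d) := (a :+ c) :+ (b :+ d)) refl (f x) (g x) (∑ xs f) (∑ xs g))

·-∑ : (k : ℚ) (xs : List A) (f : A → ℚ) → k · ∑ xs f ≡ ∑ xs (λ a → k · f a)
·-∑ k []       f = *-zeroʳ k
·-∑ k (x ∷ xs) f = trans (*-distribˡ-+ k (f x) (∑ xs f)) (cong (k · f x +_) (·-∑ k xs f))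

∑-·ʳ : (xs : List A) (f : A → ℚ) (k : ℚ) → ∑ xs (λ a → f a · k) ≡ ∑ xs f · k
∑-·ʳ xs f k = trans (∑-cong xs (λ a → *-comm (f a) k)) (trans (sym (·-∑ k xs f)) (*-comm k (∑ xs f)))

∑-neg : (xs : List A) (f : A → ℚ) → ∑ xs (λ a → - f a) ≡ - ∑ xs f
∑-neg []       f = refl
∑-neg (x ∷ xs) f = trans (cong (- f x +_) (∑-neg xs f)) (sym (neg-distrib-+ (f x) (∑ xs f)))

∑-sub : (xs : List A) (f g : A → ℚ) → ∑ xs (λ a → f a - g a) ≡ ∑ xs f - ∑ xs g
∑-sub xs f g = trans (∑-+ xs f (λ a → - g a)) (cong (∑ xs f +_) (∑-neg xs g))

∑-++ : (xs ys : List A) (f : A → ℚ) → ∑ (xs ++ ys) f ≡ ∑ xs f + ∑ ys f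
∑-++ []       ys f = sym (+-identityˡ _)
∑-++ (x ∷ xs) ys f = trans (cong (f x +_) (∑-++ xs ys f)) (sym (+-assoc (f x) _ _))

∑-concatMap : (xs : List A) (g : A → List B) (f : B → ℚ) →
              ∑ (concatMap g xs) f ≡ ∑ xs (λ a → ∑ (g a) f)
∑-concatMap []       g f = refl
∑-concatMap (x ∷ xs) g f =
  trans (∑-++ (g x) (concatMap g xs) f) (cong (∑ (g x) f +_) (∑-concatMap xs g f))

∑-map : (xs : List A) (g : A → B) (f : B → ℚ) → ∑ (map g xs) f ≡ ∑ xs (f ∘ g)
∑-map xs g f = cong sumℚ (sym (map-∘ xs))

∑-comm : (xs : List A) (ys : List B) (f : A → B → ℚ) →
         ∑ xs (λ a → ∑ ys (f a)) ≡ ∑ ys (λ b → ∑ xs (λ a → f a b))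
∑-comm []       ys f = sym (∑-zero ys (λ _ → refl))
∑-comm (x ∷ xs) ys f = trans (cong (∑ ys (f x) +_) (∑-comm xs ys f))
  (sym (∑-+ ys (f x) (λ b → ∑ xs (λ a → f a b))))

∏ : (r : ℕ) → (Fin r → ℚ) → ℚ
∏ r f = prodℚ (map f (allFin r))

map-allFin-suc : (f : Fin (suc r) → A) → map f (allFin (suc r)) ≡ f zero ∷ map (f ∘ suc) (allFin r)
map-allFin-suc f = cong (f zero ∷_) (trans (map-tabulate suc f) (sym (map-tabulate (λ i → i) (f ∘ suc))))

∑-allFin-suc : (f : Fin (suc r) → ℚ) → ∑ (allFin (suc r)) f ≡ f zero + ∑ (allFin r) (f ∘ suc)
∑-allFin-suc f = cong sumℚ (map-allFin-suc f)

∏-suc : (f : Fin (suc r) → ℚ) → ∏ (suc r) f ≡ f zero · ∏ r (f ∘ suc)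
∏-suc f = cong prodℚ (map-allFin-suc f)

∏-cong : {f g : Fin r → ℚ} → (∀ i → f i ≡ g i) → ∏ r f ≡ ∏ r g
∏-cong {r} eq = cong prodℚ (map-cong eq (allFin r))

∏-· : (f g : Fin r → ℚ) → ∏ r (λ j → f j · g j) ≡ ∏ r f · ∏ r g
∏-· {zero}  f g = refl
∏-· {suc r} f g = begin
  ∏ (suc r) (λ j → f j · g j)
    ≡⟨ ∏-suc (λ j → f j · g j) ⟩
  f zero · g zero · ∏ r (λ j → f (suc j) · g (suc j))
    ≡⟨ cong (f zero · g zero ·_) (∏-· (f ∘ suc) (g ∘ suc)) ⟩
  f zero · g zero · (∏ r (f ∘ suc) · ∏ r (g ∘ suc))
    ≡⟨ solve 4 (λ a b c d → (a :* b) :* (c :* d) := (a :* c) :* (b :* d)) refl (f zero) (g zero) _ _ ⟩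
  f zero · ∏ r (f ∘ suc) · (g zero · ∏ r (g ∘ suc))
    ≡⟨ cong₂ _·_ (∏-suc f) (∏-suc g) ⟨
  ∏ (suc r) f · ∏ (suc r) g ∎

∏-zero : (f : Fin r → ℚ) (j : Fin r) → f j ≡ 0ℚ → ∏ r f ≡ 0ℚ
∏-zero {suc r} f zero    fj≡0 =
  trans (∏-suc f) (trans (cong (_· ∏ r (f ∘ suc)) fj≡0) (*-zeroˡ (∏ r (f ∘ suc))))
∏-zero {suc r} f (suc j) fj≡0 =
  trans (∏-suc f) (trans (cong (f zero ·_) (∏-zero (f ∘ suc) j fj≡0)) (*-zeroʳ (f zero)))

∑-allVecOf-∏ : (xs : List A) (h : Fin r → A → ℚ) →
               ∑ (allVecOf xs r) (λ v → ∏ r (λ j → h j (lookup v j))) ≡ ∏ r (λ j → ∑ xs (h j))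
∑-allVecOf-∏ {r = zero}  xs h = +-identityʳ 1ℚ
∑-allVecOf-∏ {r = suc r} xs h = begin
  ∑ (concatMap (λ a → map (a ∷_) (allVecOf xs r)) xs) (λ v → ∏ (suc r) (λ j → h j (lookup v j)))
    ≡⟨ ∑-concatMap xs _ _ ⟩
  ∑ xs (λ a → ∑ (map (a ∷_) (allVecOf xs r)) (λ v → ∏ (suc r) (λ j → h j (lookup v j))))
    ≡⟨ ∑-cong xs (λ a → trans (∑-map (allVecOf xs r) (a ∷_) _)
                              (∑-cong (allVecOf xs r) (λ v → ∏-suc (λ j → h j (lookup (a ∷ v) j))))) ⟩
  ∑ xs (λ a → ∑ (allVecOf xs r) (λ v → h zero a · ∏ r (λ j → h (suc j) (lookup v j))))
    ≡⟨ ∑-cong xs (λ a → trans (sym (·-∑ (h zero a) (allVecOf xs r) _))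
                              (cong (h zero a ·_) (∑-allVecOf-∏ xs (h ∘ suc)))) ⟩
  ∑ xs (λ a → h zero a · ∏ r (λ j → ∑ xs (h (suc j))))
    ≡⟨ ∑-·ʳ xs (h zero) _ ⟩
  ∑ xs (h zero) · ∏ r (λ j → ∑ xs (h (suc j)))
    ≡⟨ sym (∏-suc (λ j → ∑ xs (h j))) ⟩
  ∏ (suc r) (λ j → ∑ xs (h j)) ∎

∏-vanishes-off : (_≟_ : DecidableEquality X) (g : Fin r → X → ℚ) (B : Vec X r) →
                 (∀ j b → b ≢ lookup B j → g j b ≡ 0ℚ) →
                 (A : Vec X r) → A ≢ B → ∏ r (λ j → g j (lookup A j)) ≡ 0ℚ
∏-vanishes-off _≟_ g []      off []      A≢B = contradiction refl A≢B
∏-vanishes-off _≟_ g (b ∷ B) off (a ∷ A) A≢B with a ≟ b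
... | no a≢b  = ∏-zero (λ j → g j (lookup (a ∷ A) j)) zero (off zero a a≢b)
... | yes refl = trans (∏-suc (λ j → g j (lookup (a ∷ A) j)))
  (trans (cong (g zero a ·_) (∏-vanishes-off _≟_ (g ∘ suc) B (off ∘ suc) A (A≢B ∘ cong (a ∷_))))
         (*-zeroʳ (g zero a)))

𝟙ᵇ : Bool → ℚ
𝟙ᵇ true  = 1ℚ
𝟙ᵇ false = 0ℚ

𝟙 : {P : Set} → Dec P → ℚ
𝟙 P? = 𝟙ᵇ (does P?)

𝟙-yes : {P : Set} (P? : Dec P) → P → 𝟙 P? ≡ 1ℚ
𝟙-yes P? p = cong 𝟙ᵇ (dec-true P? p)

𝟙-no : {P : Set} (P? : Dec P) → ¬ P → 𝟙 P? ≡ 0ℚ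
𝟙-no P? ¬p = cong 𝟙ᵇ (dec-false P? ¬p)

𝟙ᵇ-⌊⌋ : {P : Set} (P? : Dec P) → 𝟙ᵇ ⌊ P? ⌋ ≡ 𝟙 P?
𝟙ᵇ-⌊⌋ P? = cong 𝟙ᵇ (isYes≗does P?)

⌊⌋-true : {P : Set} (P? : Dec P) → P → ⌊ P? ⌋ ≡ true
⌊⌋-true P? p = trans (isYes≗does P?) (dec-true P? p)

⌊⌋-false : {P : Set} (P? : Dec P) → ¬ P → ⌊ P? ⌋ ≡ false
⌊⌋-false P? ¬p = trans (isYes≗does P?) (dec-false P? ¬p)

∑-filter : {P : A → Set} (P? : Decidable P) (xs : List A) (f : A → ℚ) →
           ∑ (filter P? xs) f ≡ ∑ xs (λ a → 𝟙 (P? a) · f a)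
∑-filter P? []       f = refl
∑-filter P? (x ∷ xs) f with does (P? x)
... | true  = cong₂ _+_ (sym (*-identityˡ (f x))) (∑-filter P? xs f)
... | false = trans (∑-filter P? xs f) (sym (trans (cong (_+ _) (*-zeroˡ (f x))) (+-identityˡ _)))

∑-filter-cong : {P : A → Set} (P? : Decidable P) (xs : List A) {f g : A → ℚ} →
                (∀ a → P a → f a ≡ g a) → ∑ (filter P? xs) f ≡ ∑ (filter P? xs) g
∑-filter-cong P? []       eq = refl
∑-filter-cong P? (x ∷ xs) eq with P? x
... | yes px = cong₂ _+_ (eq x px) (∑-filter-cong P? xs eq)
... | no  _  = ∑-filter-cong P? xs eq

𝟙ᵇ-∧ : (a b : Bool) → 𝟙ᵇ (a ∧ b) ≡ 𝟙ᵇ a · 𝟙ᵇ b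
𝟙ᵇ-∧ true  b = sym (*-identityˡ (𝟙ᵇ b))
𝟙ᵇ-∧ false b = sym (*-zeroˡ (𝟙ᵇ b))

𝟙-· : {P : Set} (P? : Dec P) {z : ℚ} → (¬ P → z ≡ 0ℚ) → 𝟙 P? · z ≡ z
𝟙-· (yes _) {z} _    = *-identityˡ z
𝟙-· (no ¬p) {z} z≡0 = trans (*-zeroˡ z) (sym (z≡0 ¬p))

𝟙ᵇ-allFinB : (b : Fin r → Bool) → 𝟙ᵇ (allFinB b) ≡ ∏ r (𝟙ᵇ ∘ b)
𝟙ᵇ-allFinB {zero}  b = refl
𝟙ᵇ-allFinB {suc r} b = begin
  𝟙ᵇ (allFinB b)                          ≡⟨ cong (𝟙ᵇ ∘ List.foldr _∧_ true) (map-allFin-suc b) ⟩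
  𝟙ᵇ (b zero ∧ allFinB (b ∘ suc))         ≡⟨ 𝟙ᵇ-∧ (b zero) _ ⟩
  𝟙ᵇ (b zero) · 𝟙ᵇ (allFinB (b ∘ suc))    ≡⟨ cong (𝟙ᵇ (b zero) ·_) (𝟙ᵇ-allFinB (b ∘ suc)) ⟩
  𝟙ᵇ (b zero) · ∏ r (𝟙ᵇ ∘ b ∘ suc)        ≡⟨ sym (∏-suc (𝟙ᵇ ∘ b)) ⟩
  ∏ (suc r) (𝟙ᵇ ∘ b)                      ∎

if-true : {b : Bool} {x y : A} → b ≡ true → (if b then x else y) ≡ x
if-true refl = refl

if-false : {b : Bool} {x y : A} → b ≡ false → (if b then x else y) ≡ y
if-false refl = refl

anyFin-suc : (f : Fin (suc r) → Bool) → anyFin f ≡ f zero ∨ anyFin (f ∘ suc)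
anyFin-suc f = cong (List.foldr _∨_ false) (map-allFin-suc f)

anyFin-intro : (f : Fin r → Bool) (i : Fin r) → f i ≡ true → anyFin f ≡ true
anyFin-intro f zero    fi≡true = trans (anyFin-suc f) (cong (_∨ anyFin (f ∘ suc)) fi≡true)
anyFin-intro f (suc i) fi≡true =
  trans (anyFin-suc f) (trans (cong (f zero ∨_) (anyFin-intro (f ∘ suc) i fi≡true)) (∨-zeroʳ (f zero)))

anyFin-elim : (f : Fin r → Bool) → anyFin f ≡ true → ∃ λ i → f i ≡ true
anyFin-elim {suc r} f any≡true = split (trans (sym (anyFin-suc f)) any≡true)
  where
  split : f zero ∨ anyFin (f ∘ suc) ≡ true → ∃ λ i → f i ≡ true
  split _ with f zero in f0≡b
  ... | true  = zero , f0≡b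
  split rest≡true | false = let i , fi≡true = anyFin-elim (f ∘ suc) rest≡true in suc i , fi≡true

countFin-cong : {f g : Fin r → Bool} → (∀ i → f i ≡ g i) → countFin f ≡ countFin g
countFin-cong {r} eq = cong (List.foldr (λ b k → if b then suc k else k) 0) (map-cong eq (allFin r))

∏-sign : (b : Fin r → Bool) → ∏ r (λ j → if b j then - 1ℚ else 1ℚ) ≡ sign (countFin b)
∏-sign {zero}  b = refl
∏-sign {suc r} b =
  trans (∏-suc (λ j → if b j then - 1ℚ else 1ℚ)) (trans (split (b zero)) (cong sign (sym countFin-suc)))
  where
  countFin-suc : countFin b ≡ (if b zero then suc (countFin (b ∘ suc)) else countFin (b ∘ suc))
  countFin-suc = cong (List.foldr (λ b k → if b then suc k else k) 0) (map-allFin-suc b)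
  P : ℚ
  P = ∏ r (λ j → if b (suc j) then - 1ℚ else 1ℚ)
  split : ∀ b₀ → (if b₀ then - 1ℚ else 1ℚ) · P
                 ≡ sign (if b₀ then suc (countFin (b ∘ suc)) else countFin (b ∘ suc))
  split true  = trans (sym (neg-distribˡ-* 1ℚ P)) (cong -_ (trans (*-identityˡ P) (∏-sign (b ∘ suc))))
  split false = trans (*-identityˡ P) (∏-sign (b ∘ suc))

-- xs lists every element of A exactly once, phrased as the sifting property of sums over xs.
Enumerates : List A → Set
Enumerates {A} xs = ∀ s (f : A → ℚ) → (∀ a → a ≢ s → f a ≡ 0ℚ) → ∑ xs f ≡ f s

allFin-enumerates : (r : ℕ) → Enumerates (allFin r)
allFin-enumerates (suc r) zero    f off =
  trans (∑-allFin-suc f) (trans (cong (f zero +_) (∑-zero (allFin r) (λ a → off (suc a) λ ())))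
                                (+-identityʳ (f zero)))
allFin-enumerates (suc r) (suc s) f off =
  trans (∑-allFin-suc f)
        (trans (cong₂ _+_ (off zero λ ())
                          (allFin-enumerates r s (f ∘ suc) (λ a a≢s → off (suc a) (a≢s ∘ suc-injective))))
               (+-identityˡ (f (suc s))))

bools-enumerates : Enumerates (true ∷ false ∷ [])
bools-enumerates true  f off = trans (cong (λ q → f true + (q + 0ℚ)) (off false λ ())) (+-identityʳ _)
bools-enumerates false f off =
  trans (cong (λ q → q + (f false + 0ℚ)) (off true λ ())) (trans (+-identityˡ _) (+-identityʳ _))

allVecOf-enumerates : (xs : List A) → Enumerates xs → (r : ℕ) → Enumerates (allVecOf xs r)
allVecOf-enumerates xs enum zero    []      f off = +-identityʳ (f [])
allVecOf-enumerates xs enum (suc r) (s ∷ S) f off = begin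
  ∑ (concatMap (λ a → map (a ∷_) (allVecOf xs r)) xs) f
    ≡⟨ ∑-concatMap xs (λ a → map (a ∷_) (allVecOf xs r)) f ⟩
  ∑ xs (λ a → ∑ (map (a ∷_) (allVecOf xs r)) f)
    ≡⟨ ∑-cong xs (λ a → ∑-map (allVecOf xs r) (a ∷_) f) ⟩
  ∑ xs (λ a → ∑ (allVecOf xs r) (λ T → f (a ∷ T)))
    ≡⟨ enum s _ (λ a a≢s → ∑-zero (allVecOf xs r) (λ T → off (a ∷ T) (a≢s ∘ cong Vec.head))) ⟩
  ∑ (allVecOf xs r) (λ T → f (s ∷ T))
    ≡⟨ allVecOf-enumerates xs enum r S _ (λ T T≢S → off (s ∷ T) (T≢S ∘ cong Vec.tail)) ⟩
  f (s ∷ S) ∎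

δ : Vec (Fin n) r → Vec (Fin n) r → ℚ
δ S T = 𝟙 (≡-decVec _≟F_ S T)

distinct? : (T : Vec (Fin n) r) → Dec (Unique (toList T))
distinct? T = UniqueDec.unique? _≟F_ (toList T)

∑-tuples-δ : (S : Vec (Fin n) r) → Unique (toList S) → (g : Vec (Fin n) r → ℚ) →
             ∑ (tuples n r) (λ T → g T · δ S T) ≡ g S
∑-tuples-δ {n} {r} S S-distinct g = begin
  ∑ (tuples n r) (λ T → g T · δ S T)
    ≡⟨ ∑-filter distinct? (allVecOf (allFin n) r) _ ⟩
  ∑ (allVecOf (allFin n) r) (λ T → 𝟙 (distinct? T) · (g T · δ S T))
    ≡⟨ allVecOf-enumerates (allFin n) (allFin-enumerates n) r S _ off-S ⟩
  𝟙 (distinct? S) · (g S · δ S S)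
    ≡⟨ cong₂ (λ a b → a · (g S · b)) (𝟙-yes (distinct? S) S-distinct) (𝟙-yes (≡-decVec _≟F_ S S) refl) ⟩
  1ℚ · (g S · 1ℚ)
    ≡⟨ trans (*-identityˡ _) (*-identityʳ (g S)) ⟩
  g S ∎
  where
  off-S : ∀ T → T ≢ S → 𝟙 (distinct? T) · (g T · δ S T) ≡ 0ℚ
  off-S T T≢S = trans (cong (λ b → 𝟙 (distinct? T) · (g T · b)) (𝟙-no (≡-decVec _≟F_ S T) (T≢S ∘ sym)))
                      (trans (cong (𝟙 (distinct? T) ·_) (*-zeroʳ (g T))) (*-zeroʳ (𝟙 (distinct? T))))

δ-as-∏ : (S T : Vec (Fin n) r) → δ S T ≡ ∏ r (λ j → 𝟙 (lookup S j ≟F lookup T j))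
δ-as-∏ []      []      = refl
δ-as-∏ (s ∷ S) (t ∷ T) = begin
  δ (s ∷ S) (t ∷ T)
    ≡⟨ 𝟙ᵇ-∧ (does (s ≟F t)) _ ⟩
  𝟙 (s ≟F t) · δ S T
    ≡⟨ cong (𝟙 (s ≟F t) ·_) (δ-as-∏ S T) ⟩
  𝟙 (s ≟F t) · ∏ _ (λ j → 𝟙 (lookup S j ≟F lookup T j))
    ≡⟨ ∏-suc (λ j → 𝟙 (lookup (s ∷ S) j ≟F lookup (t ∷ T) j)) ⟨
  ∏ _ (λ j → 𝟙 (lookup (s ∷ S) j ≟F lookup (t ∷ T) j)) ∎

all-lookup : {P : A → Set} (v : Vec A r) → All P (toList v) → ∀ i → P (lookup v i)
all-lookup (x ∷ v) (px ∷ _)   zero    = px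
all-lookup (x ∷ v) (_  ∷ pxs) (suc i) = all-lookup v pxs i

unique⇒lookup-injective : {v : Vec A r} → Unique (toList v) → ∀ {i j} → lookup v i ≡ lookup v j → i ≡ j
unique⇒lookup-injective {v = x ∷ v} (x∉v ∷ _) {zero}  {zero}  eq = refl
unique⇒lookup-injective {v = x ∷ v} (x∉v ∷ _) {zero}  {suc j} eq = contradiction eq (all-lookup v x∉v j)
unique⇒lookup-injective {v = x ∷ v} (x∉v ∷ _) {suc i} {zero}  eq = contradiction (sym eq) (all-lookup v x∉v i)
unique⇒lookup-injective {v = x ∷ v} (_ ∷ u)   {suc i} {suc j} eq = cong suc (unique⇒lookup-injective u eq)

lookup⇒all : {P : A → Set} (v : Vec A r) → (∀ i → P (lookup v i)) → All P (toList v)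
lookup⇒all []      p = []
lookup⇒all (x ∷ v) p = p zero ∷ lookup⇒all v (p ∘ suc)

lookup-injective⇒unique : (v : Vec A r) → (∀ {i j} → lookup v i ≡ lookup v j → i ≡ j) → Unique (toList v)
lookup-injective⇒unique []      inj = []
lookup-injective⇒unique (x ∷ v) inj =
  lookup⇒all v (λ i eq → 0≢1+n (inj eq)) ∷ lookup-injective⇒unique v (suc-injective ∘ inj)

map-lookup-unique : {σ : Vec A n} (v : Vec (Fin n) r) → Unique (toList σ) → Unique (toList v) →
                    Unique (toList (Vec.map (lookup σ) v))
map-lookup-unique v σ-distinct v-distinct = lookup-injective⇒unique _ λ {i} {j} eq →
  unique⇒lookup-injective v-distinct
    (unique⇒lookup-injective σ-distinct (trans (sym (lookup-map i _ v)) (trans eq (lookup-map j _ v))))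

unique-⊆ : {xs ys : List A} → xs ⊆ ys → Unique ys → Unique xs
unique-⊆ []         []            = []
unique-⊆ (y ∷ʳ xs⊆ys) (_ ∷ u)     = unique-⊆ xs⊆ys u
unique-⊆ (refl ∷ xs⊆ys) (y∉ys ∷ u) = All-resp-⊆ xs⊆ys y∉ys ∷ unique-⊆ xs⊆ys u

removeAt-⊆ : (v : Vec A (suc r)) (k : Fin (suc r)) → toList (removeAt v k) ⊆ toList v
removeAt-⊆ (x ∷ v)     zero    = x ∷ʳ ⊆-refl
removeAt-⊆ (x ∷ y ∷ v) (suc k) = refl ∷ removeAt-⊆ (y ∷ v) k

map-removeAt : (f : A → B) (v : Vec A (suc r)) (k : Fin (suc r)) →
               Vec.map f (removeAt v k) ≡ removeAt (Vec.map f v) k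
map-removeAt f (x ∷ v)     zero    = refl
map-removeAt f (x ∷ y ∷ v) (suc k) = cong (f x ∷_) (map-removeAt f (y ∷ v) k)

module _ {m : ℕ} where

  unlabelAt : Flag m (suc r) → Fin (suc r) → Flag m r
  unlabelAt F k = record
    { labeled          = removeAt (labeled F) k
    ; labeled-distinct = unique-⊆ (removeAt-⊆ (labeled F) k) (labeled-distinct F)
    ; edges            = edges F
    ; edges-distinct   = edges-distinct F
    ; covers           = covers F
    }

  unlabelAt-unlabels : (F : Flag m (suc r)) (k : Fin (suc r)) → Unlabels (unlabelAt F k) F
  unlabelAt-unlabels {r} F k = refl , n<1+n r , removeAt-⊆ (labeled F) k

  module _ (F : Flag m r) (x : List (Fin n) → ℚ) where

    weight : Vec (Fin n) m → ℚ
    weight σ = prodℚ (map (λ e → x (map (lookup σ) e)) (edges F))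

    -- The linear extension g ↦ ∑_L g(L) p_{F,L} of L ↦ p_{F,L}, summed over the embeddings σ instead.
    pLinear : (Vec (Fin n) r → ℚ) → ℚ
    pLinear g = ∑ (tuples n m) (λ σ → weight σ · g (Vec.map (lookup σ) (labeled F)))

    p-as-pLinear : (L : Vec (Fin n) r) → p F L x ≡ pLinear (λ S → δ S L)
    p-as-pLinear L =
      trans (∑-filter (λ σ → ≡-decVec _≟F_ (Vec.map (lookup σ) (labeled F)) L) (tuples n m) weight)
            (∑-cong (tuples n m) (λ σ → *-comm _ (weight σ)))

    pLinear-∑ : (xs : List A) (g : A → Vec (Fin n) r → ℚ) →
                ∑ xs (λ a → pLinear (g a)) ≡ pLinear (λ S → ∑ xs (λ a → g a S))
    pLinear-∑ xs g = trans (∑-comm xs (tuples n m) _)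
      (∑-cong (tuples n m) (λ σ → sym (·-∑ (weight σ) xs (λ a → g a (Vec.map (lookup σ) (labeled F))))))

    ·-pLinear : (k : ℚ) (g : Vec (Fin n) r → ℚ) → k · pLinear g ≡ pLinear (λ S → k · g S)
    ·-pLinear k g = trans (·-∑ k (tuples n m) _) (∑-cong (tuples n m) λ σ →
      trans (sym (*-assoc k _ _)) (trans (cong (_· _) (*-comm k (weight σ))) (*-assoc (weight σ) k _)))

    ∑-·-pLinear : (xs : List A) (w : A → ℚ) (g : A → Vec (Fin n) r → ℚ) →
                  ∑ xs (λ a → w a · pLinear (g a)) ≡ pLinear (λ S → ∑ xs (λ a → w a · g a S))
    ∑-·-pLinear xs w g = trans (∑-cong xs (λ a → ·-pLinear (w a) (g a))) (pLinear-∑ xs (λ a S → w a · g a S))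

    pLinear-sub : (g h : Vec (Fin n) r → ℚ) → pLinear g - pLinear h ≡ pLinear (λ S → g S - h S)
    pLinear-sub g h = trans (sym (∑-sub (tuples n m) _ _))
                            (∑-cong (tuples n m) λ σ → sym (x[y-z]≈xy-xz (weight σ) _ _))

    pLinear-cong : {g h : Vec (Fin n) r → ℚ} →
                   (∀ S → Unique (toList S) → g S ≡ h S) → pLinear g ≡ pLinear h
    pLinear-cong eq = ∑-filter-cong distinct? (allVecOf (allFin n) m) λ σ σ-distinct →
      cong (weight σ ·_) (eq _ (map-lookup-unique (labeled F) σ-distinct (labeled-distinct F)))

  ∑-·-p : (F : Flag m r) (x : List (Fin n) → ℚ) (xs : List A) (w : A → ℚ) (T : A → Vec (Fin n) r) →
          ∑ xs (λ a → w a · p F (T a) x) ≡ pLinear F x (λ S → ∑ xs (λ a → w a · δ S (T a)))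
  ∑-·-p F x xs w T = trans (∑-cong xs (λ a → cong (w a ·_) (p-as-pLinear F x (T a))))
                           (∑-·-pLinear F x xs w (λ a S → δ S (T a)))

  pLinear-unlabelAt : (F : Flag m (suc r)) (k : Fin (suc r)) (x : List (Fin n) → ℚ) (g : Vec (Fin n) r → ℚ) →
                      pLinear (unlabelAt F k) x g ≡ pLinear F x (λ S → g (removeAt S k))
  pLinear-unlabelAt {n = n} F k x g = ∑-cong (tuples n m) λ σ →
    cong (λ v → weight F x σ · g v) (map-removeAt (lookup σ) (labeled F) k)

data Forgetful (X : Set) : ℕ → Set where
  forgetting : Fin (suc r) → (Vec X r → ℚ) → Forgetful X (suc r)

⟦_⟧ : Forgetful X r → Vec X r → ℚ
⟦ forgetting k G ⟧ S = G (removeAt S k)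

∑⟦_⟧ : List (Forgetful X r) → Vec X r → ℚ
∑⟦ fs ⟧ S = ∑ fs (λ f → ⟦ f ⟧ S)

scale : ℚ → Forgetful X r → Forgetful X r
scale c (forgetting k G) = forgetting k (λ T → c · G T)

⟦scale⟧ : (c : ℚ) (f : Forgetful X r) (S : Vec X r) → ⟦ scale c f ⟧ S ≡ c · ⟦ f ⟧ S
⟦scale⟧ c (forgetting k G) S = refl

∑⟦map-scale⟧ : (c : ℚ) (fs : List (Forgetful X r)) (S : Vec X r) →
               ∑⟦ map (scale c) fs ⟧ S ≡ c · ∑⟦ fs ⟧ S
∑⟦map-scale⟧ c fs S = begin
  ∑⟦ map (scale c) fs ⟧ S      ≡⟨ ∑-map fs (scale c) (λ f → ⟦ f ⟧ S) ⟩
  ∑ fs (λ f → ⟦ scale c f ⟧ S) ≡⟨ ∑-cong fs (λ f → ⟦scale⟧ c f S) ⟩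
  ∑ fs (λ f → c · ⟦ f ⟧ S)     ≡⟨ sym (·-∑ c fs (λ f → ⟦ f ⟧ S)) ⟩
  c · ∑⟦ fs ⟧ S                ∎

_⊗_ : (X → ℚ) → Forgetful X r → Forgetful X (suc r)
a ⊗ forgetting k G = forgetting (suc k) (λ T → a (Vec.head T) · G (Vec.tail T))

⟦⊗⟧ : (a : X → ℚ) (f : Forgetful X r) (s : X) (S : Vec X r) → ⟦ a ⊗ f ⟧ (s ∷ S) ≡ a s · ⟦ f ⟧ S
⟦⊗⟧ a (forgetting k G) s (_ ∷ S) = refl

-- With P and Q the products of the remaining factors, (a₀ - β₀) P - a₀ Q = - β₀ P + a₀ (P - Q):
-- the first summand ignores coordinate 0, and P - Q is telescoped recursively.
telescope : (a : Fin r → X → ℚ) (β : Fin r → ℚ) → List (Forgetful X r)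
telescope {r = zero}  a β = []
telescope {r = suc r} a β =
  forgetting zero (λ T → - β zero · ∏ r (λ j → a (suc j) (lookup T j) - β (suc j)))
  ∷ map (a zero ⊗_) (telescope (a ∘ suc) (β ∘ suc))

telescope-sound : (a : Fin r → X → ℚ) (β : Fin r → ℚ) (S : Vec X r) →
  ∏ r (λ j → a j (lookup S j) - β j) - ∏ r (λ j → a j (lookup S j)) ≡ ∑⟦ telescope a β ⟧ S
telescope-sound {r = zero}  a β [] = +-inverseʳ 1ℚ
telescope-sound {r = suc r} a β (s ∷ S) = begin
  ∏ (suc r) (λ j → a j (lookup (s ∷ S) j) - β j) - ∏ (suc r) (λ j → a j (lookup (s ∷ S) j))
    ≡⟨ cong₂ _-_ (∏-suc (λ j → a j (lookup (s ∷ S) j) - β j)) (∏-suc (λ j → a j (lookup (s ∷ S) j))) ⟩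
  (a zero s - β zero) · P - a zero s · Q
    ≡⟨ solve 4 (λ a b x y → (a :- b) :* x :- a :* y := (:- b) :* x :+ a :* (x :- y))
               refl (a zero s) (β zero) P Q ⟩
  - β zero · P + a zero s · (P - Q)
    ≡⟨ cong (λ q → - β zero · P + a zero s · q) (telescope-sound (a ∘ suc) (β ∘ suc) S) ⟩
  - β zero · P + a zero s · ∑⟦ rest ⟧ S
    ≡⟨ cong (- β zero · P +_) (·-∑ (a zero s) rest (λ f → ⟦ f ⟧ S)) ⟩
  - β zero · P + ∑ rest (λ f → a zero s · ⟦ f ⟧ S)
    ≡⟨ cong (- β zero · P +_) (sym (trans (∑-map rest (a zero ⊗_) (λ f → ⟦ f ⟧ (s ∷ S)))
                                          (∑-cong rest (λ f → ⟦⊗⟧ (a zero) f s S)))) ⟩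
  ∑⟦ telescope a β ⟧ (s ∷ S) ∎
  where
  P = ∏ r (λ j → a (suc j) (lookup S j) - β (suc j))
  Q = ∏ r (λ j → a (suc j) (lookup S j))
  rest = telescope (a ∘ suc) (β ∘ suc)

module _ {m : ℕ} where

  termsOf : (F : Flag m r) → Forgetful (Fin n) r → List (Term n F)
  termsOf {n = n} F (forgetting k G) = mapWith∈ (tuples n _) λ {T} T∈tuples → record
    { r′          = _
    ; F′          = unlabelAt F k
    ; unlabels    = unlabelAt-unlabels F k
    ; L′          = T
    ; L′-distinct = proj₂ (∈-filter⁻ distinct? {xs = allVecOf (allFin n) _} T∈tuples)
    ; coeff       = G T
    }

  termsOf-sound : (F : Flag m r) (x : List (Fin n) → ℚ) (f : Forgetful (Fin n) r) →
                  evalTerms (termsOf F f) x ≡ pLinear F x ⟦ f ⟧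
  termsOf-sound {r = suc r} {n = n} F x (forgetting k G) = begin
    evalTerms (termsOf F (forgetting k G)) x
      ≡⟨ cong sumℚ (trans (map-mapWith∈ (tuples n r) _ _)
                          (mapWith∈≗map (λ T → G T · p Fₖ T x) (tuples n r))) ⟩
    ∑ (tuples n r) (λ T → G T · p Fₖ T x)
      ≡⟨ ∑-·-p Fₖ x (tuples n r) G (λ T → T) ⟩
    pLinear Fₖ x (λ S → ∑ (tuples n r) (λ T → G T · δ S T))
      ≡⟨ pLinear-cong Fₖ x (λ S S-distinct → ∑-tuples-δ S S-distinct G) ⟩
    pLinear Fₖ x G
      ≡⟨ pLinear-unlabelAt F k x G ⟩
    pLinear F x ⟦ forgetting k G ⟧ ∎
    where
    Fₖ = unlabelAt F k

  terms : (F : Flag m r) → List (Forgetful (Fin n) r) → List (Term n F)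
  terms F = concatMap (termsOf F)

  terms-sound : (F : Flag m r) (x : List (Fin n) → ℚ) (fs : List (Forgetful (Fin n) r)) →
                evalTerms (terms F fs) x ≡ pLinear F x ∑⟦ fs ⟧
  terms-sound F x fs = begin
    evalTerms (terms F fs) x
      ≡⟨ ∑-concatMap fs (termsOf F) (λ t → Term.coeff t · p (Term.F′ t) (Term.L′ t) x) ⟩
    ∑ fs (λ f → evalTerms (termsOf F f) x)
      ≡⟨ ∑-cong fs (termsOf-sound F x) ⟩
    ∑ fs (λ f → pLinear F x ⟦ f ⟧)
      ≡⟨ pLinear-∑ F x fs ⟦_⟧ ⟩
    pLinear F x ∑⟦ fs ⟧ ∎

module Labels (L : Vec (Fin n) r) (L-distinct : Unique (toList L)) where

  private
    L-injective : ∀ {i j} → lookup L i ≡ lookup L j → i ≡ j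
    L-injective = unique⇒lookup-injective L-distinct

  inL : Fin n → ℚ
  inL s = ∑ (allFin r) (λ i → 𝟙 (s ≟F lookup L i))

  inL-∈ : ∀ {s} i → lookup L i ≡ s → inL s ≡ 1ℚ
  inL-∈ {s} i Lᵢ≡s = trans
    (allFin-enumerates r i _ (λ i′ i′≢i → 𝟙-no (s ≟F lookup L i′) λ s≡Lᵢ′ →
                                i′≢i (L-injective (trans (sym s≡Lᵢ′) (sym Lᵢ≡s)))))
    (𝟙-yes (s ≟F lookup L i) (sym Lᵢ≡s))

  inL-∉ : ∀ {s} → (∀ i → lookup L i ≢ s) → inL s ≡ 0ℚ
  inL-∉ {s} ∉L = ∑-zero (allFin r) (λ i → 𝟙-no (s ≟F lookup L i) (λ s≡Lᵢ → ∉L i (sym s≡Lᵢ)))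

  -- factor b j s counts the positions i with lᵢ = s whose label may be moved to position j:
  -- every such i if b, and only i = j otherwise.
  factor : Bool → Fin r → Fin n → ℚ
  factor true  j s = inL s
  factor false j s = 𝟙 (s ≟F lookup L j)

  fixesOutside : Vec Bool r → Vec (Fin r) r → Bool
  fixesOutside A π = allFinB (λ i → lookup A i ∨ ⌊ lookup π i ≟F i ⌋)

  fixing : Vec Bool r → List (Vec (Fin r) r)
  fixing A = filter (λ π → T? (fixesOutside A π)) (perms r)

  arrangements : Vec Bool r → Vec (Fin n) r → ℚ
  arrangements A S = ∏ r (λ j → factor (lookup A j) j (lookup S j))

  permute : Vec (Fin r) r → Vec (Fin n) r
  permute π = tabulate (λ i → lookup L (lookup π i))

  permute-≡⇒distinct : (S : Vec (Fin n) r) → Unique (toList S) →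
                       (π : Vec (Fin r) r) → permute π ≡ S → Unique (toList π)
  permute-≡⇒distinct S S-distinct π Lπ≡S = lookup-injective⇒unique π λ {i} {j} πᵢ≡πⱼ →
    unique⇒lookup-injective S-distinct (begin
      lookup S i           ≡⟨ cong (λ v → lookup v i) Lπ≡S ⟨
      lookup (permute π) i ≡⟨ lookup∘tabulate _ i ⟩
      lookup L (lookup π i) ≡⟨ cong (lookup L) πᵢ≡πⱼ ⟩
      lookup L (lookup π j) ≡⟨ lookup∘tabulate _ j ⟨
      lookup (permute π) j ≡⟨ cong (λ v → lookup v j) Lπ≡S ⟩
      lookup S j           ∎)

  ∑-fixing-δ : (A : Vec Bool r) (S : Vec (Fin n) r) → Unique (toList S) →
               ∑ (fixing A) (λ π → δ S (permute π)) ≡ arrangements A S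
  ∑-fixing-δ A S S-distinct = begin
    ∑ (fixing A) (λ π → δ S (permute π))
      ≡⟨ ∑-filter (λ π → T? (fixesOutside A π)) (perms r) _ ⟩
    ∑ (perms r) (λ π → 𝟙ᵇ (fixesOutside A π) · δ S (permute π))
      ≡⟨ ∑-filter distinct? (allVecOf (allFin r) r) _ ⟩
    ∑ (allVecOf (allFin r) r) (λ π → 𝟙 (distinct? π) · (𝟙ᵇ (fixesOutside A π) · δ S (permute π)))
      ≡⟨ ∑-cong (allVecOf (allFin r) r) (λ π → 𝟙-· (distinct? π) λ π-repeats →
           trans (cong (𝟙ᵇ (fixesOutside A π) ·_)
                       (𝟙-no (≡-decVec _≟F_ S (permute π))
                             (π-repeats ∘ permute-≡⇒distinct S S-distinct π ∘ sym)))
                 (*-zeroʳ (𝟙ᵇ (fixesOutside A π)))) ⟩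
    ∑ (allVecOf (allFin r) r) (λ π → 𝟙ᵇ (fixesOutside A π) · δ S (permute π))
      ≡⟨ ∑-cong (allVecOf (allFin r) r) (λ π → trans
           (cong₂ _·_ (𝟙ᵇ-allFinB (λ j → lookup A j ∨ ⌊ lookup π j ≟F j ⌋))
                      (trans (δ-as-∏ S (permute π))
                             (∏-cong (λ j → cong (λ t → 𝟙 (lookup S j ≟F t)) (lookup∘tabulate _ j)))))
           (sym (∏-· (λ j → mayMove (lookup A j) j (lookup π j)) (λ j → hits j (lookup π j))))) ⟩
    ∑ (allVecOf (allFin r) r) (λ π → ∏ r (λ j → mayMove (lookup A j) j (lookup π j) · hits j (lookup π j)))
      ≡⟨ ∑-allVecOf-∏ (allFin r) (λ j i → mayMove (lookup A j) j i · hits j i) ⟩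
    ∏ r (λ j → ∑ (allFin r) (λ i → mayMove (lookup A j) j i · hits j i))
      ≡⟨ ∏-cong (λ j → ∑-column (lookup A j) j) ⟩
    arrangements A S ∎
    where
    mayMove : Bool → Fin r → Fin r → ℚ
    mayMove b j i = 𝟙ᵇ (b ∨ ⌊ i ≟F j ⌋)
    hits : Fin r → Fin r → ℚ
    hits j i = 𝟙 (lookup S j ≟F lookup L i)
    ∑-column : ∀ b j → ∑ (allFin r) (λ i → mayMove b j i · hits j i) ≡ factor b j (lookup S j)
    ∑-column true  j = ∑-cong (allFin r) (λ i → *-identityˡ (hits j i))
    ∑-column false j = trans
      (allFin-enumerates r j _ λ i i≢j →
         trans (cong (_· hits j i) (trans (𝟙ᵇ-⌊⌋ (i ≟F j)) (𝟙-no (i ≟F j) i≢j))) (*-zeroˡ (hits j i)))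
      (trans (cong (_· hits j j) (trans (𝟙ᵇ-⌊⌋ (j ≟F j)) (𝟙-yes (j ≟F j) refl))) (*-identityˡ (hits j j)))

  crosses : Vec (Fin n) r → Fin r → Fin r → Bool
  crosses S i j = not ⌊ i ≟F j ⌋ ∧ ⌊ lookup S j ≟F lookup L i ⌋

  c-as-if : (S : Vec (Fin n) r) → let z = countFin (λ i → not ⌊ lookup S i ≟F lookup L i ⌋) in
            c L S ≡ (if anyFin (λ i → anyFin (crosses S i)) then 0ℚ else sign z · invℚ (natℚ (fall n r z)))
  c-as-if S = refl

  c-crossing : (S : Vec (Fin n) r) (i j : Fin r) → i ≢ j → lookup S j ≡ lookup L i → c L S ≡ 0ℚ
  c-crossing S i j i≢j Sⱼ≡Lᵢ = trans (c-as-if S) (if-true (anyFin-intro _ i (anyFin-intro _ j crosses-ij)))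
    where
    crosses-ij : crosses S i j ≡ true
    crosses-ij = cong₂ (λ a b → not a ∧ b) (⌊⌋-false (i ≟F j) i≢j) (⌊⌋-true (_ ≟F _) Sⱼ≡Lᵢ)

  crosses⇒ : (S : Vec (Fin n) r) (i j : Fin r) → crosses S i j ≡ true → i ≢ j × lookup S j ≡ lookup L i
  crosses⇒ S i j _ with i ≟F j | lookup S j ≟F lookup L i
  crosses⇒ S i j () | yes _ | _
  crosses⇒ S i j () | no _  | no _
  ... | no i≢j | yes Sⱼ≡Lᵢ = i≢j , Sⱼ≡Lᵢ

  noncrossing⇒ : (S : Vec (Fin n) r) → (∀ i j → i ≢ j → lookup S j ≢ lookup L i) →
                 anyFin (λ i → anyFin (crosses S i)) ≡ false
  noncrossing⇒ S noncrossing with anyFin (λ i → anyFin (crosses S i)) in crossing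
  ... | false = refl
  ... | true  = let i , crosses-i = anyFin-elim _ crossing
                    j , crosses-ij = anyFin-elim _ crosses-i
                    i≢j , Sⱼ≡Lᵢ = crosses⇒ S i j crosses-ij
                in contradiction Sⱼ≡Lᵢ (noncrossing i j i≢j)

  c-noncrossing : (S : Vec (Fin n) r) → (∀ i j → i ≢ j → lookup S j ≢ lookup L i) →
                  let z = countFin (λ i → not ⌊ lookup S i ≟F lookup L i ⌋) in
                  c L S ≡ sign z · invℚ (natℚ (fall n r z))
  c-noncrossing S noncrossing = trans (c-as-if S) (if-false (noncrossing⇒ S noncrossing))

  invFall : Vec Bool r → ℚ
  invFall A = invℚ (natℚ (fall n r (card A)))

  moved : Vec (Fin n) r → Vec Bool r
  moved S = tabulate (λ j → not ⌊ lookup S j ≟F lookup L j ⌋)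

  moved-stays : (S : Vec (Fin n) r) (j : Fin r) → lookup S j ≡ lookup L j → lookup (moved S) j ≡ false
  moved-stays S j Sⱼ≡Lⱼ = trans (lookup∘tabulate _ j) (cong not (⌊⌋-true (_ ≟F _) Sⱼ≡Lⱼ))

  moved-moves : (S : Vec (Fin n) r) (j : Fin r) → lookup S j ≢ lookup L j → lookup (moved S) j ≡ true
  moved-moves S j Sⱼ≢Lⱼ = trans (lookup∘tabulate _ j) (cong not (⌊⌋-false (_ ≟F _) Sⱼ≢Lⱼ))

  shifted : Vec (Fin n) r → Fin r → Bool → ℚ
  shifted S j b = factor b j (lookup S j) - 𝟙ᵇ b

  shifted-off : (S : Vec (Fin n) r) (j : Fin r) (b : Bool) → b ≢ lookup (moved S) j → shifted S j b ≡ 0ℚ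
  shifted-off S j b b≢movedⱼ with lookup S j ≟F lookup L j | b
  ... | yes Sⱼ≡Lⱼ | true  = trans (cong (_- 1ℚ) (inL-∈ j (sym Sⱼ≡Lⱼ))) (+-inverseʳ 1ℚ)
  ... | yes Sⱼ≡Lⱼ | false = contradiction (sym (moved-stays S j Sⱼ≡Lⱼ)) b≢movedⱼ
  ... | no Sⱼ≢Lⱼ  | true  = contradiction (sym (moved-moves S j Sⱼ≢Lⱼ)) b≢movedⱼ
  ... | no Sⱼ≢Lⱼ  | false = trans (cong (_- 0ℚ) (𝟙-no (lookup S j ≟F lookup L j) Sⱼ≢Lⱼ)) (+-inverseʳ 0ℚ)

  crossing? : (S : Vec (Fin n) r) → Dec (∃₂ λ i j → i ≢ j × lookup S j ≡ lookup L i)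
  crossing? S = any? λ i → any? λ j → ¬? (i ≟F j) ×-dec (lookup S j ≟F lookup L i)

  c-at-moved : (S : Vec (Fin n) r) → Dec (∃₂ λ i j → i ≢ j × lookup S j ≡ lookup L i) →
               c L S ≡ invFall (moved S) · ∏ r (λ j → shifted S j (lookup (moved S) j))
  c-at-moved S (yes (i , j , i≢j , Sⱼ≡Lᵢ)) = begin
    c L S ≡⟨ c-crossing S i j i≢j Sⱼ≡Lᵢ ⟩
    0ℚ    ≡⟨ trans (cong (invFall (moved S) ·_) (∏-zero _ j shiftedⱼ≡0)) (*-zeroʳ (invFall (moved S))) ⟨
    invFall (moved S) · ∏ r (λ j → shifted S j (lookup (moved S) j)) ∎
    where
    Sⱼ≢Lⱼ : lookup S j ≢ lookup L j
    Sⱼ≢Lⱼ Sⱼ≡Lⱼ = i≢j (L-injective (trans (sym Sⱼ≡Lᵢ) Sⱼ≡Lⱼ))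
    shiftedⱼ≡0 : shifted S j (lookup (moved S) j) ≡ 0ℚ
    shiftedⱼ≡0 = trans (cong (shifted S j) (moved-moves S j Sⱼ≢Lⱼ))
                       (trans (cong (_- 1ℚ) (inL-∈ i (sym Sⱼ≡Lᵢ))) (+-inverseʳ 1ℚ))
  c-at-moved S (no noncrossing) = begin
    c L S ≡⟨ c-noncrossing S (λ i j i≢j Sⱼ≡Lᵢ → noncrossing (i , j , i≢j , Sⱼ≡Lᵢ)) ⟩
    sign z · invℚ (natℚ (fall n r z))
      ≡⟨ *-comm (sign z) _ ⟩
    invℚ (natℚ (fall n r z)) · sign z
      ≡⟨ cong₂ (λ k q → invℚ (natℚ (fall n r k)) · q) (sym card-moved)
               (sym (trans (∏-cong shifted-at-moved) (∏-sign (λ j → not ⌊ lookup S j ≟F lookup L j ⌋)))) ⟩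
    invFall (moved S) · ∏ r (λ j → shifted S j (lookup (moved S) j)) ∎
    where
    z = countFin (λ i → not ⌊ lookup S i ≟F lookup L i ⌋)
    card-moved : card (moved S) ≡ z
    card-moved = countFin-cong (lookup∘tabulate (λ j → not ⌊ lookup S j ≟F lookup L j ⌋))
    shifted-at-moved : ∀ j → shifted S j (lookup (moved S) j)
                             ≡ (if not ⌊ lookup S j ≟F lookup L j ⌋ then - 1ℚ else 1ℚ)
    shifted-at-moved j with lookup S j ≟F lookup L j
    ... | yes Sⱼ≡Lⱼ = trans (cong (shifted S j) (moved-stays S j Sⱼ≡Lⱼ))
                            (trans (cong (_- 0ℚ) (𝟙-yes (lookup S j ≟F lookup L j) Sⱼ≡Lⱼ)) (+-identityʳ 1ℚ))
    ... | no Sⱼ≢Lⱼ  = trans (cong (shifted S j) (moved-moves S j Sⱼ≢Lⱼ))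
                            (trans (cong (_- 1ℚ) (inL-∉ Sⱼ∉L)) (+-identityˡ (- 1ℚ)))
      where
      Sⱼ∉L : ∀ i → lookup L i ≢ lookup S j
      Sⱼ∉L i Lᵢ≡Sⱼ with i ≟F j
      ... | yes refl = Sⱼ≢Lⱼ (sym Lᵢ≡Sⱼ)
      ... | no i≢j   = noncrossing (i , j , i≢j , sym Lᵢ≡Sⱼ)

  c-as-∑-subsets : (S : Vec (Fin n) r) →
                   c L S ≡ ∑ (subsets r) (λ A → invFall A · ∏ r (λ j → shifted S j (lookup A j)))
  c-as-∑-subsets S = trans (c-at-moved S (crossing? S)) (sym
    (allVecOf-enumerates _ bools-enumerates r (moved S) _ λ A A≢moved →
      trans (cong (invFall A ·_) (∏-vanishes-off _≟B_ (shifted S) (moved S) (shifted-off S) A A≢moved))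
            (*-zeroʳ (invFall A))))

  symmetrized : Vec (Fin n) r → ℚ
  symmetrized S = ∑ (subsets r) (λ A → invFall A · arrangements A S)

  telescopeAt : Vec Bool r → List (Forgetful (Fin n) r)
  telescopeAt A = telescope (λ j → factor (lookup A j) j) (𝟙ᵇ ∘ lookup A)

  correction : List (Forgetful (Fin n) r)
  correction = concatMap (λ A → map (scale (invFall A)) (telescopeAt A)) (subsets r)

  correction-sound : (S : Vec (Fin n) r) → c L S - symmetrized S ≡ ∑⟦ correction ⟧ S
  correction-sound S = begin
    c L S - symmetrized S
      ≡⟨ cong (_- symmetrized S) (c-as-∑-subsets S) ⟩
    ∑ (subsets r) (λ A → invFall A · ∏ r (λ j → shifted S j (lookup A j))) - symmetrized S
      ≡⟨ sym (∑-sub (subsets r) _ _) ⟩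
    ∑ (subsets r) (λ A → invFall A · ∏ r (λ j → shifted S j (lookup A j)) - invFall A · arrangements A S)
      ≡⟨ ∑-cong (subsets r) (λ A → trans (sym (x[y-z]≈xy-xz (invFall A) _ _))
                                         (cong (invFall A ·_) (telescope-sound _ (𝟙ᵇ ∘ lookup A) S))) ⟩
    ∑ (subsets r) (λ A → invFall A · ∑⟦ telescopeAt A ⟧ S)
      ≡⟨ ∑-cong (subsets r) (λ A → sym (∑⟦map-scale⟧ (invFall A) (telescopeAt A) S)) ⟩
    ∑ (subsets r) (λ A → ∑⟦ map (scale (invFall A)) (telescopeAt A) ⟧ S)
      ≡⟨ sym (∑-concatMap (subsets r) _ (λ f → ⟦ f ⟧ S)) ⟩
    ∑⟦ correction ⟧ S ∎

  module _ {m : ℕ} (F : Flag m r) (x : List (Fin n) → ℚ) where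

    φ-as-pLinear : φ F L x ≡ pLinear F x (c L)
    φ-as-pLinear = trans (∑-·-p F x (tuples n r) (c L) (λ L′ → L′))
                         (pLinear-cong F x (λ S S-distinct → ∑-tuples-δ S S-distinct (c L)))

    symSum-as-pLinear : symSum F L x ≡ pLinear F x symmetrized
    symSum-as-pLinear = begin
      symSum F L x
        ≡⟨ ∑-cong (subsets r) (λ A → cong (invFall A ·_) (trans
             (∑-cong (fixing A) (λ π → p-as-pLinear F x (permute π)))
             (pLinear-∑ F x (fixing A) (λ π S → δ S (permute π))))) ⟩
      ∑ (subsets r) (λ A → invFall A · pLinear F x (λ S → ∑ (fixing A) (λ π → δ S (permute π))))
        ≡⟨ ∑-·-pLinear F x (subsets r) invFall (λ A S → ∑ (fixing A) (λ π → δ S (permute π))) ⟩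
      pLinear F x (λ S → ∑ (subsets r) (λ A → invFall A · ∑ (fixing A) (λ π → δ S (permute π))))
        ≡⟨ pLinear-cong F x (λ S S-distinct → ∑-cong (subsets r) (λ A →
             cong (invFall A ·_) (∑-fixing-δ A S S-distinct))) ⟩
      pLinear F x symmetrized ∎

mainTheorem11 :
    (n : ℕ) (ordered : Bool) (EP : List (Fin n) → Set) →
    (∀ e → EP e → Unique e) →
    (∀ (τ : Permutation′ n) e → EP e → EP (map (τ ⟨$⟩ʳ_) e)) →
    (r m : ℕ) → 2 * r ≤ n →
    (L : Vec (Fin n) r) → Unique (toList L) →
    (F : Flag m r) →
    Σ (List (Term n F)) (λ ts →
      (x : List (Fin n) → ℚ) → Admissible ordered EP x →
      φ F L x - symSum F L x ≡ evalTerms ts x)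
mainTheorem11 n _ _ _ _ r m _ L L-distinct F = terms F correction , λ x _ → begin
  φ F L x - symSum F L x
    ≡⟨ cong₂ _-_ (φ-as-pLinear F x) (symSum-as-pLinear F x) ⟩
  pLinear F x (c L) - pLinear F x symmetrized
    ≡⟨ pLinear-sub F x (c L) symmetrized ⟩
  pLinear F x (λ S → c L S - symmetrized S)
    ≡⟨ pLinear-cong F x (λ S _ → correction-sound S) ⟩
  pLinear F x ∑⟦ correction ⟧
    ≡⟨ terms-sound F x correction ⟨
  evalTerms (terms F correction) x ∎
  where open Labels L L-distinct
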